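{- Let $G$ be a finite connected graph with no induced subgraph isomorphic to $4K_1$ that has a cut vertex. Then $c(G)\le 2$.
   Context: $4K_1$ is the edgeless graph on $4$ vertices. A cut vertex is a vertex whose removal disconnects the graph. The cop number $c(G)$ is the minimum number of cops guaranteeing capture in the standard game of cops and robber (cops placed first, then robber; alternately each cop moves to an adjacent vertex or stays, then the robber moves to an adjacent vertex or stays; full information; capture when a cop occupies the robber's vertex). -}

module Defs where

open import Data.Nat using (ℕ; _≤_)
open import Data.Fin using (Fin)
open import Data.Bool using (Bool; true; false)
open import Data.Product using (Σ; ∃; ∃-syntax; _×_; _,_)
open import Data.Sum using (_⊎_)
open import Data.Unit using (⊤)
open import Relation.Nullary using (¬_)
open import Relation.Binary.PropositionalEquality using (_≡_; _≢_)

record Graph : Set where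
  field
    n     : ℕ
    adj   : Fin n → Fin n → Bool
    sym   : ∀ u v → adj u v ≡ adj v u
    irrefl : ∀ v → adj v v ≡ false

module _ (G : Graph) where
  open Graph G

  Vertex : Set
  Vertex = Fin n

  Adj : Vertex → Vertex → Set
  Adj u v = adj u v ≡ true

  -- u = v or u adjacent to v (a legal move: stay or move along an edge)
  ClosedAdj : Vertex → Vertex → Set
  ClosedAdj u v = u ≡ v ⊎ Adj u v

  data ReachIn (P : Vertex → Set) : Vertex → Vertex → Set where
    here : ∀ {u} → P u → ReachIn P u u
    step : ∀ {u v w} → P u → Adj u v → ReachIn P v w → ReachIn P u w

  Connected : Set
  Connected = ∀ u w → ReachIn (λ _ → ⊤) u w

  IsCutVertex : Vertex → Set
  IsCutVertex v = ∃[ u ] ∃[ w ] (u ≢ v × w ≢ v × ¬ ReachIn (λ x → x ≢ v) u w)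

  HasCutVertex : Set
  HasCutVertex = ∃[ v ] IsCutVertex v

  Induced4K1 : Set
  Induced4K1 = ∃[ a ] ∃[ b ] ∃[ c ] ∃[ d ]
    ( (a ≢ b × a ≢ c × a ≢ d × b ≢ c × b ≢ d × c ≢ d)
    × (¬ Adj a b × ¬ Adj a c × ¬ Adj a d × ¬ Adj b c × ¬ Adj b d × ¬ Adj c d))

  Captured : ∀ {k} → (Fin k → Vertex) → Vertex → Set
  Captured C r = ∃[ i ] C i ≡ r

  -- CopsWinFrom C r : cops at positions C, robber at r, cops to move;
  -- the cops can force capture in finitely many rounds.
  data CopsWinFrom {k : ℕ} : (Fin k → Vertex) → Vertex → Set where
    move : ∀ {C r} (C' : Fin k → Vertex)
         → (∀ i → ClosedAdj (C i) (C' i))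
         → (Captured C' r
            ⊎ (∀ r' → ClosedAdj r r' → Captured C' r' ⊎ CopsWinFrom C' r'))
         → CopsWinFrom C r

  -- k cops win: cops are placed first, then the robber, then the cops move.
  CopsWin : ℕ → Set
  CopsWin k = Σ (Fin k → Vertex) λ C → ∀ r → Captured C r ⊎ CopsWinFrom C r

  -- c(G) ≤ m : some number k ≤ m of cops wins (c(G) is the minimum such k)
  CopNumber≤ : ℕ → Set
  CopNumber≤ m = ∃[ k ] (k ≤ m × CopsWin k)

-- Let v be a cut vertex, and call two vertices far if they are distinct and
-- non-adjacent.  As G has no 4K₁, any three pairwise far vertices dominate G.
-- If for every robber position r outside N[v] the vertices outside N[v] in
-- r's component of G − v are dominated by one vertex t, one cop guards v
-- while the other walks to t.  This is the case when V − N[v] contains no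
-- far pair, and when a far pair x, y outside N[v] is separated by v, since
-- x, y, v dominate G.  Otherwise x and y lie in one component C of G − v:
-- every vertex outside C ∪ {v} is adjacent to v, and C is dominated by a
-- neighbour s of v and one further vertex, for three pairwise far vertices
-- of C and a vertex beyond v would form a 4K₁.  The cops start on these two
-- vertices; a robber not caught at once is outside C, and the cop on s
-- steps to v.
module Submission where

open import Defs
open import Relation.Nullary using (¬_)
open import Data.Product using (_×_)

open import Data.Nat using (_≤_; zero; suc; s≤s)
open import Data.Nat.Properties using (≤-refl; <-≤-trans)
open import Data.Fin using (Fin; zero; suc)
open import Data.Fin.Properties using (any?) renaming (_≟_ to _≟ᶠ_)
open import Data.Bool using (true)
open import Data.Bool.Properties using () renaming (_≟_ to _≟ᵇ_)
open import Data.Product using (∃-syntax; _,_; proj₁; proj₂)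
open import Data.Sum using (_⊎_; inj₁; inj₂; [_,_]; swap)
open import Function using (_∘_)
open import Data.Unit using (⊤)
open import Data.Empty using (⊥-elim)
open import Data.List using (List; []; length; filter; allFin)
open import Data.List.Properties using (filter-notAll)
import Data.List.Relation.Unary.Any as Any
open import Data.List.Membership.Propositional using (_∈_)
open import Data.List.Membership.Propositional.Properties
  using (∈-filter⁺; ∈-filter⁻; ∈-allFin)
open import Relation.Nullary using (Dec; yes; no; ¬?)
open import Relation.Nullary.Decidable using (map′; _×-dec_; _⊎-dec_)
open import Relation.Unary using (Decidable)
open import Relation.Binary.PropositionalEquality
  using (_≡_; _≢_; refl; sym; trans)

module _ (G : Graph) where

  adj? : (a b : Vertex G) → Dec (Adj G a b)
  adj? a b = Graph.adj G a b ≟ᵇ true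

  Adj-sym : ∀ {a b} → Adj G a b → Adj G b a
  Adj-sym {a} {b} = trans (Graph.sym G b a)

  closedAdj? : (a b : Vertex G) → Dec (ClosedAdj G a b)
  closedAdj? a b = (a ≟ᶠ b) ⊎-dec adj? a b

  ClosedAdj-sym : ∀ {a b} → ClosedAdj G a b → ClosedAdj G b a
  ClosedAdj-sym (inj₁ refl) = inj₁ refl
  ClosedAdj-sym (inj₂ e)    = inj₂ (Adj-sym e)

  Far : Vertex G → Vertex G → Set
  Far a b = ¬ ClosedAdj G a b

  Far-sym : ∀ {a b} → Far a b → Far b a
  Far-sym f c = f (ClosedAdj-sym c)

  Far⇒≢ : ∀ {a b} → Far a b → b ≢ a
  Far⇒≢ f b≡a = f (inj₁ (sym b≡a))

  module _ {P : Vertex G → Set} where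

    reach-source : ∀ {a b} → ReachIn G P a b → P a
    reach-source (here p)     = p
    reach-source (step p _ _) = p

    reach-trans : ∀ {a b c} → ReachIn G P a b → ReachIn G P b c → ReachIn G P a c
    reach-trans (here _)     w = w
    reach-trans (step p e u) w = step p e (reach-trans u w)

    reach-sym : ∀ {a b} → ReachIn G P a b → ReachIn G P b a
    reach-sym (here p)     = here p
    reach-sym (step p e w) = reach-trans (reach-sym w) (step (reach-source w) (Adj-sym e) (here p))

    ClosedAdj⇒reach : ∀ {a b} → P a → P b → ClosedAdj G a b → ReachIn G P a b
    ClosedAdj⇒reach pa _  (inj₁ refl) = here pa
    ClosedAdj⇒reach pa pb (inj₂ e)    = step pa e (here pb)

    split-at-last-visit : ∀ a {b c} → ReachIn G P b c →
      ReachIn G (λ z → P z × z ≢ a) b c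
      ⊎ a ≡ c
      ⊎ ∃[ d ] Adj G a d × ReachIn G (λ z → P z × z ≢ a) d c
    split-at-last-visit a {b} (here p) with b ≟ᶠ a
    ... | yes refl = inj₂ (inj₁ refl)
    ... | no b≢a   = inj₁ (here (p , b≢a))
    split-at-last-visit a {b} (step p e w) with split-at-last-visit a w
    ... | inj₂ later = inj₂ later
    ... | inj₁ w′ with b ≟ᶠ a
    ...   | yes refl = inj₂ (inj₂ (_ , e , w′))
    ...   | no b≢a   = inj₁ (step (p , b≢a) e w′)

  reach-map : ∀ {P Q : Vertex G → Set} → (∀ {z} → P z → Q z) →
              ∀ {a b} → ReachIn G P a b → ReachIn G Q a b
  reach-map f (here p)     = here (f p)
  reach-map f (step p e w) = step (f p) e (reach-map f w)

  entry-neighbour : ∀ {a v} → a ≢ v → ReachIn G (λ _ → ⊤) a v →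
                    ∃[ s ] Adj G v s × ReachIn G (_≢ v) a s
  entry-neighbour a≢v (here _) = ⊥-elim (a≢v refl)
  entry-neighbour {a} {v} a≢v (step {v = a′} _ e w) with a′ ≟ᶠ v
  ... | yes refl = a , Adj-sym e , here a≢v
  ... | no a′≢v with entry-neighbour a′≢v w
  ...   | s , vs , w′ = s , vs , step a≢v e w′

  private
    without : Vertex G → List (Vertex G) → List (Vertex G)
    without a = filter (λ z → ¬? (z ≟ᶠ a))

  -- Removing the source from the allowed set strictly shortens it, so the
  -- recursion is on an explicit bound k on its length.
  reachWithin? : ∀ k (S : List (Vertex G)) → length S ≤ k →
                 (a b : Vertex G) → Dec (ReachIn G (_∈ S) a b)
  reachWithin? zero [] _ a b = no λ w → noMember (reach-source w)
    where
      noMember : ¬ a ∈ []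
      noMember ()
  reachWithin? (suc k) S |S|≤1+k a b with Any.any? (a ≟ᶠ_) S
  ... | no a∉S = no λ w → a∉S (reach-source w)
  ... | yes a∈S with a ≟ᶠ b
  ...   | yes refl = yes (here a∈S)
  ...   | no a≢b with any? (λ d → adj? a d ×-dec reachWithin? k (without a S) |S∖a|≤k d b)
    where
      |S∖a|≤k : length (without a S) ≤ k
      |S∖a|≤k with <-≤-trans (filter-notAll _ S (Any.map (λ a≡z z≡a → z≡a (sym a≡z)) a∈S)) |S|≤1+k
      ... | s≤s le = le
  ...     | yes (d , e , w) = yes (step a∈S e (reach-map (λ z∈ → proj₁ (∈-filter⁻ _ z∈)) w))
  ...     | no none = no impossible
    where
      impossible : ¬ ReachIn G (_∈ S) a b
      impossible w with split-at-last-visit a w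
      ... | inj₁ w′ = proj₂ (reach-source w′) refl
      ... | inj₂ (inj₁ a≡b) = a≢b a≡b
      ... | inj₂ (inj₂ (d , e , w′)) =
        none (d , e , reach-map (λ (z∈ , z≢a) → ∈-filter⁺ _ z∈ z≢a) w′)

  reachIn? : ∀ {P : Vertex G → Set} → Decidable P →
             (a b : Vertex G) → Dec (ReachIn G P a b)
  reachIn? P? a b =
    map′ (reach-map λ z∈ → proj₂ (∈-filter⁻ P? {xs = allFin _} z∈))
         (reach-map λ pz → ∈-filter⁺ P? (∈-allFin _) pz)
         (reachWithin? _ S ≤-refl a b)
    where
      S : List (Vertex G)
      S = filter P? (allFin _)

  four-far⇒Induced4K1 : ∀ {a b c d} → Far a b → Far a c → Far a d →
                         Far b c → Far b d → Far c d → Induced4K1 G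
  four-far⇒Induced4K1 ab ac ad bc bd cd =
    _ , _ , _ , _
    , (≢ ab , ≢ ac , ≢ ad , ≢ bc , ≢ bd , ≢ cd)
    , (≁ ab , ≁ ac , ≁ ad , ≁ bc , ≁ bd , ≁ cd)
    where
      ≢ : ∀ {x y} → Far x y → x ≢ y
      ≢ f = f ∘ inj₁
      ≁ : ∀ {x y} → Far x y → ¬ Adj G x y
      ≁ f e = f (inj₂ e)

  far-triple-dominates : ¬ Induced4K1 G → ∀ {a b c} →
    Far a b → Far a c → Far b c →
    ∀ z → ClosedAdj G a z ⊎ ClosedAdj G b z ⊎ ClosedAdj G c z
  far-triple-dominates no4K1 {a} {b} {c} ab ac bc z
    with closedAdj? a z | closedAdj? b z | closedAdj? c z
  ... | yes az | _      | _      = inj₁ az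
  ... | no _   | yes bz | _      = inj₂ (inj₁ bz)
  ... | no _   | no _   | yes cz = inj₂ (inj₂ cz)
  ... | no az  | no bz  | no cz  = ⊥-elim (no4K1 (four-far⇒Induced4K1 ab ac az bc bz cz))

  cops : Vertex G → Vertex G → Fin 2 → Vertex G
  cops a b zero       = a
  cops a b (suc zero) = b

  capture-by-first : ∀ {a b r} → ClosedAdj G a r → CopsWinFrom G (cops a b) r
  capture-by-first {b = b} {r} ar = move (cops r b) moves (inj₁ (zero , refl))
    where
      moves : ∀ i → ClosedAdj G (cops _ b i) (cops r b i)
      moves zero       = ar
      moves (suc zero) = inj₁ refl

  capture-by-second : ∀ {a b r} → ClosedAdj G b r → CopsWinFrom G (cops a b) r
  capture-by-second {a} {r = r} br = move (cops a r) moves (inj₁ (suc zero , refl))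
    where
      moves : ∀ i → ClosedAdj G (cops a _ i) (cops a r i)
      moves zero       = inj₁ refl
      moves (suc zero) = br

  -- The first cop stays on v, so the robber cannot enter N[v]; he is
  -- confined to P while the second cop walks to t, which dominates P.
  guard-and-chase : (v t : Vertex G) (P : Vertex G → Set) →
    (∀ {z z′} → P z → ClosedAdj G z z′ → Far v z′ → P z′) →
    (∀ {z} → P z → ClosedAdj G t z) →
    ∀ {c r} → ReachIn G (λ _ → ⊤) c t → P r → CopsWinFrom G (cops v c) r
  guard-and-chase v t P closed dominated (here _) pr = capture-by-second (dominated pr)
  guard-and-chase v t P closed dominated {c} {r} (step {v = c′} _ e w) pr =
    move (cops v c′) moves (inj₂ reply)
    where
      moves : ∀ i → ClosedAdj G (cops v c i) (cops v c′ i)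
      moves zero       = inj₁ refl
      moves (suc zero) = inj₂ e
      reply : ∀ r′ → ClosedAdj G r r′ → Captured G (cops v c′) r′ ⊎ CopsWinFrom G (cops v c′) r′
      reply r′ rr′ with closedAdj? v r′
      ... | yes vr′ = inj₂ (capture-by-first vr′)
      ... | no far  = inj₂ (guard-and-chase v t P closed dominated w (closed pr rr′ far))

  guard-wins : Connected G → (v : Vertex G) →
    (∀ r → Far v r → ∃[ t ] ∀ z → Far v z → ReachIn G (_≢ v) z r → ClosedAdj G t z) →
    CopsWin G 2
  guard-wins conn v dominator = cops v v , λ r → inj₂ (strategy r)
    where
      strategy : ∀ r → CopsWinFrom G (cops v v) r
      strategy r with closedAdj? v r
      ... | yes vr = capture-by-first vr
      ... | no vr with dominator r vr
      ...   | t , dominated =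
        guard-and-chase v t P closed (λ (vz , zr) → dominated _ vz zr)
                        (conn v t) (vr , here (Far⇒≢ vr))
        where
          P : Vertex G → Set
          P z = Far v z × ReachIn G (_≢ v) z r
          closed : ∀ {z z′} → P z → ClosedAdj G z z′ → Far v z′ → P z′
          closed (vz , zr) zz′ vz′ =
            vz′ , reach-trans (ClosedAdj⇒reach (Far⇒≢ vz′) (Far⇒≢ vz) (ClosedAdj-sym zz′)) zr

  advance-wins : ∀ a a′ b → ClosedAdj G a a′ →
    (∀ r → Far a r → Far b r → ∀ r′ → ClosedAdj G r r′ → ClosedAdj G a′ r′) →
    CopsWin G 2
  advance-wins a a′ b aa′ trapped = cops a b , λ r → inj₂ (strategy r)
    where
      strategy : ∀ r → CopsWinFrom G (cops a b) r
      strategy r with closedAdj? a r | closedAdj? b r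
      ... | yes ar | _      = capture-by-first ar
      ... | no _   | yes br = capture-by-second br
      ... | no ar  | no br  = move (cops a′ b) moves
          (inj₂ λ r′ rr′ → inj₂ (capture-by-first (trapped r ar br r′ rr′)))
        where
          moves : ∀ i → ClosedAdj G (cops a b i) (cops a′ b i)
          moves zero       = aa′
          moves (suc zero) = inj₁ refl

  module AroundVertex (conn : Connected G) (v : Vertex G) where

    Rv : Vertex G → Vertex G → Set
    Rv = ReachIn G (_≢ v)

    Rv? : (a b : Vertex G) → Dec (Rv a b)
    Rv? = reachIn? (λ z → ¬? (z ≟ᶠ v))

    FarPair : Set
    FarPair = ∃[ x ] ∃[ y ] Far v x × Far v y × Far x y

    farPair? : Dec FarPair
    farPair? = any? λ x → any? λ y → ¬? (closedAdj? v x) ×-dec ¬? (closedAdj? v y) ×-dec ¬? (closedAdj? x y)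

    no-far-pair-wins : ¬ FarPair → CopsWin G 2
    no-far-pair-wins none = guard-wins conn v λ r vr → r , λ z vz _ → adjacent r z vr vz
      where
        adjacent : ∀ r z → Far v r → Far v z → ClosedAdj G r z
        adjacent r z vr vz with closedAdj? r z
        ... | yes rz = rz
        ... | no rz  = ⊥-elim (none (r , z , vr , vz , rz))

    cut-leaves-unreachable : IsCutVertex G v → ∀ x → ∃[ b ] b ≢ v × ¬ Rv b x
    cut-leaves-unreachable (u , w , u≢v , w≢v , u↛w) x with Rv? u x
    ... | no u↛x  = u , u≢v , u↛x
    ... | yes u↝x = w , w≢v , λ w↝x → u↛w (reach-trans u↝x (reach-sym w↝x))

    far-pair-covers : ¬ Induced4K1 G → ∀ {x y} → Far v x → Far v y → Far x y →
                      ∀ z → Far v z → ClosedAdj G x z ⊎ ClosedAdj G y z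
    far-pair-covers no4K1 vx vy xy z vz
      with far-triple-dominates no4K1 xy (Far-sym vx) (Far-sym vy) z
    ... | inj₁ xz          = inj₁ xz
    ... | inj₂ (inj₁ yz)   = inj₂ yz
    ... | inj₂ (inj₂ vz′)  = ⊥-elim (vz vz′)

    separated-side-dominated : ∀ {x y} → Far v y →
      (∀ z → Far v z → ClosedAdj G x z ⊎ ClosedAdj G y z) → ¬ Rv x y →
      ∀ z → Far v z → Rv z x → ClosedAdj G x z
    separated-side-dominated vy cover x↛y z vz z↝x with cover z vz
    ... | inj₁ xz = xz
    ... | inj₂ yz = ⊥-elim (x↛y (reach-trans (reach-sym z↝x)
                                 (ClosedAdj⇒reach (Far⇒≢ vz) (Far⇒≢ vy) (ClosedAdj-sym yz))))

    separated-far-pair-wins : ¬ Induced4K1 G → ∀ {x y} → Far v x → Far v y → Far x y →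
                              ¬ Rv x y → CopsWin G 2
    separated-far-pair-wins no4K1 {x} {y} vx vy xy x↛y = guard-wins conn v dominator
      where
        cover : ∀ z → Far v z → ClosedAdj G x z ⊎ ClosedAdj G y z
        cover = far-pair-covers no4K1 vx vy xy
        dominator : ∀ r → Far v r → ∃[ t ] ∀ z → Far v z → Rv z r → ClosedAdj G t z
        dominator r vr with cover r vr
        ... | inj₁ xr = x , λ z vz z↝r → separated-side-dominated vy cover x↛y z vz
                (reach-trans z↝r (ClosedAdj⇒reach (Far⇒≢ vr) (Far⇒≢ vx) (ClosedAdj-sym xr)))
        ... | inj₂ yr = y , λ z vz z↝r → separated-side-dominated vx (λ z vz → swap (cover z vz))
                (x↛y ∘ reach-sym) z vz
                (reach-trans z↝r (ClosedAdj⇒reach (Far⇒≢ vr) (Far⇒≢ vy) (ClosedAdj-sym yr)))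

    -- C, the component of x in G − v, contains y; b lies outside C.
    joined-far-pair-wins : ¬ Induced4K1 G → ∀ {x y b} → Far v x → Far v y → Far x y →
                           Rv x y → b ≢ v → ¬ Rv b x → CopsWin G 2
    joined-far-pair-wins no4K1 {x} {y} {b} vx vy xy x↝y b≢v b↛x =
      advance-wins s v (proj₁ companion) (inj₂ (Adj-sym vs)) trapped
      where
        entry : ∃[ s ] Adj G v s × Rv x s
        entry = entry-neighbour (Far⇒≢ vx) (conn x v)
        s : Vertex G
        s = proj₁ entry
        vs : Adj G v s
        vs = proj₁ (proj₂ entry)
        s↝x : Rv s x
        s↝x = reach-sym (proj₂ (proj₂ entry))

        b-far : ∀ {z} → Rv z x → Far b z
        b-far z↝x (inj₁ refl) = b↛x z↝x
        b-far z↝x (inj₂ bz)   = b↛x (step b≢v bz z↝x)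

        outside-adjacent : ∀ z → z ≢ v → ¬ Rv z x → Adj G v z
        outside-adjacent z z≢v z↛x with closedAdj? v z
        ... | yes (inj₁ v≡z) = ⊥-elim (z≢v (sym v≡z))
        ... | yes (inj₂ vz)  = vz
        ... | no vz with far-pair-covers no4K1 vx vy xy z vz
        ...   | inj₁ xz = ⊥-elim (z↛x (ClosedAdj⇒reach z≢v (Far⇒≢ vx) (ClosedAdj-sym xz)))
        ...   | inj₂ yz = ⊥-elim (z↛x (reach-trans
                  (ClosedAdj⇒reach z≢v (Far⇒≢ vy) (ClosedAdj-sym yz)) (reach-sym x↝y)))

        -- If some z₀ ∈ C is far from s, then s, z₀, b are pairwise far and
        -- dominate G, while b is far from all of C.
        companion : ∃[ y′ ] ∀ z → Rv z x → ClosedAdj G s z ⊎ ClosedAdj G y′ z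
        companion with any? (λ z → Rv? z x ×-dec ¬? (closedAdj? s z))
        ... | no none = s , near
          where
            near : ∀ z → Rv z x → ClosedAdj G s z ⊎ ClosedAdj G s z
            near z z↝x with closedAdj? s z
            ... | yes sz = inj₁ sz
            ... | no sz  = ⊥-elim (none (z , z↝x , sz))
        ... | yes (z₀ , z₀↝x , sz₀) = z₀ , near
          where
            near : ∀ z → Rv z x → ClosedAdj G s z ⊎ ClosedAdj G z₀ z
            near z z↝x with far-triple-dominates no4K1 sz₀ (Far-sym (b-far s↝x)) (Far-sym (b-far z₀↝x)) z
            ... | inj₁ sz          = inj₁ sz
            ... | inj₂ (inj₁ z₀z)  = inj₂ z₀z
            ... | inj₂ (inj₂ bz)   = ⊥-elim (b-far z↝x bz)

        trapped : ∀ r → Far s r → Far (proj₁ companion) r →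
                  ∀ r′ → ClosedAdj G r r′ → ClosedAdj G v r′
        trapped r sr y′r r′ rr′ = escape rr′
          where
            r↛x : ¬ Rv r x
            r↛x r↝x = [ sr , y′r ] (proj₂ companion r r↝x)
            r≢v : r ≢ v
            r≢v refl = sr (inj₂ (Adj-sym vs))
            escape : ClosedAdj G r r′ → ClosedAdj G v r′
            escape (inj₁ refl) = inj₂ (outside-adjacent r r≢v r↛x)
            escape (inj₂ e) with r′ ≟ᶠ v
            ... | yes refl = inj₁ refl
            ... | no r′≢v  = inj₂ (outside-adjacent r′ r′≢v (r↛x ∘ step r≢v e))

lemma4p2 : (G : Graph) → Connected G → ¬ Induced4K1 G → HasCutVertex G
    → CopNumber≤ G 2
lemma4p2 G conn no4K1 (v , cut) = 2 , ≤-refl , wins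
  where
    open AroundVertex G conn v
    wins : CopsWin G 2
    wins with farPair?
    ... | no none = no-far-pair-wins none
    ... | yes (x , y , vx , vy , xy) with Rv? x y | cut-leaves-unreachable cut x
    ...   | no x↛y  | _ = separated-far-pair-wins no4K1 vx vy xy x↛y
    ...   | yes x↝y | b , b≢v , b↛x = joined-far-pair-wins no4K1 vx vy xy x↝y b≢v b↛x
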